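{- Let $t\ge 3$ and $\Delta\ge 4$ be integers, and let $P_t$ be a path with vertices $p_1,\dots,p_t$. Form an intermediate tree by appending onto every vertex $p_j$ exactly $\Delta-2$ copies of the $\Delta$-star $K_{1,\Delta}$, each attached by identifying one of its leaves with $p_j$. Then, for each $j$, subdivide exactly one edge between $p_j$ and one of the star centers adjacent to $p_j$. Let $T_{t,\Delta}$ be the resulting tree and let $n$ be its order. Then \[ \gamma^{\rm ID}(T_{t,\Delta})=\left(\frac{\Delta-1+\frac{1}{\Delta-2}}{\Delta+\frac{2}{\Delta-2}}\right) n > \left(\frac{\Delta-1}{\Delta}\right)n-\frac{n}{\Delta^2}. \]
   Context: An identifying code of a graph $G$ is a set $C\subseteq V(G)$ such that every vertex $v$ satisfies $N[v]\cap C\neq\emptyset$ and distinct vertices $u,v$ satisfy $N[u]\cap C\neq N[v]\cap C$, where $N[v]$ is the closed neighborhood; $\gamma^{\rm ID}(G)$ is the minimum size of an identifying code. -}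

module Defs where

open import Data.Nat using (ℕ; suc; _∸_)
open import Data.Fin using (Fin; toℕ)
open import Data.Product using (Σ; ∃; _×_)
open import Data.Sum using (_⊎_)
open import Data.List using (List; length)
open import Data.List.Membership.Propositional using (_∈_)
open import Data.List.Relation.Unary.Unique.Propositional using (Unique)
open import Relation.Binary.PropositionalEquality using (_≡_; _≢_)
open import Relation.Nullary using (¬_)
open import Function.Bundles using (_⇔_)
open import Data.Nat using (_≤_)

-- Simple graphs given by a vertex type and an adjacency relation
-- (the relation is taken symmetrically via closed neighbourhoods below).

record Graph : Set₁ where
  field
    Vertex : Set
    Adj    : Vertex → Vertex → Set

module _ (G : Graph) where
  open Graph G

  Edge : Vertex → Vertex → Set
  Edge u v = Adj u v ⊎ Adj v u

  InClosedNbhd : Vertex → Vertex → Set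
  InClosedNbhd v w = v ≡ w ⊎ Edge v w

  IsIdentifyingCode : List Vertex → Set
  IsIdentifyingCode C =
    ((v : Vertex) → ∃ λ w → w ∈ C × InClosedNbhd v w)
    × ((u v : Vertex) → u ≢ v →
         ¬ ((w : Vertex) → w ∈ C → (InClosedNbhd u w ⇔ InClosedNbhd v w)))

  IsGammaID : ℕ → Set
  IsGammaID k =
    (Σ (List Vertex) λ C → Unique C × IsIdentifyingCode C × length C ≡ k)
    × ((C : List Vertex) → Unique C → IsIdentifyingCode C → k ≤ length C)

-- The tree T_{t,Δ}.
-- path j        : p_j  (j < t)
-- center j s    : centre of the s-th Δ-star appended at p_j (s < Δ-2)
-- leaf j s l    : the Δ-1 leaves of that star other than p_j (l < Δ-1)
-- sub j         : the vertex subdividing the edge p_j — (center j 0)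

data TV (t Δ : ℕ) : Set where
  path   : Fin t → TV t Δ
  center : Fin t → Fin (Δ ∸ 2) → TV t Δ
  leaf   : Fin t → Fin (Δ ∸ 2) → Fin (Δ ∸ 1) → TV t Δ
  sub    : Fin t → TV t Δ

data TAdj (t Δ : ℕ) : TV t Δ → TV t Δ → Set where
  path-path   : (i j : Fin t) → toℕ j ≡ suc (toℕ i) → TAdj t Δ (path i) (path j)
  path-center : (j : Fin t) (s : Fin (Δ ∸ 2)) → toℕ s ≢ 0 →
                TAdj t Δ (path j) (center j s)
  path-sub    : (j : Fin t) → TAdj t Δ (path j) (sub j)
  sub-center  : (j : Fin t) (s : Fin (Δ ∸ 2)) → toℕ s ≡ 0 →
                TAdj t Δ (sub j) (center j s)
  center-leaf : (j : Fin t) (s : Fin (Δ ∸ 2)) (l : Fin (Δ ∸ 1)) →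
                TAdj t Δ (center j s) (leaf j s l)

T : ℕ → ℕ → Graph
T t Δ = record { Vertex = TV t Δ ; Adj = TAdj t Δ }

{-# OPTIONS --safe #-}
module Submission where

-- The path vertices together with all star leaves form an identifying code of size
-- t((Δ−1)(Δ−2)+1).  Conversely, the same index set injects into any identifying code C:
-- a leaf goes to itself if it lies in C and otherwise to its star centre, which then
-- lies in C by domination (two absent leaves of one star would both see only the
-- centre); p_j goes to itself, else to the subdivision vertex s_j, else to the centre c_j
-- dominating s_j, and no absent leaf of that star can also be sent to c_j, since it and
-- s_j would both see only c_j.  With n = t(Δ(Δ−2)+2) this gives the ratio, and the
-- inequality is ((Δ−1)(Δ−2)+1)Δ² = ((Δ−1)Δ−1)(Δ(Δ−2)+2) + 2.

open import Defs
open import Data.Nat using (ℕ; zero; suc; _≤_; _<_; _*_; _+_; _∸_; s≤s; z≤n)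
open import Data.Nat.Properties
  using ( ≤-reflexive; n≤1+n; m<n⇒m≤1+n; m≤n+m; m≤m+n; m≤n⇒m<n∨m≡n; <-cmp; <⇒≱; <-≤-trans
        ; 1+n≢n; m+n∸n≡m; m<m+n)
open import Data.Nat.Tactic.RingSolver using (solve-∀)
open import Data.Fin using (Fin; zero; suc; toℕ; inject₁)
open import Data.Fin.Properties
  using (toℕ-injective; toℕ-inject₁; injective⇒≤; cantor-schröder-bernstein; +↔⊎; *↔×; inj⇒≟)
  renaming (_≟_ to _≟F_)
open import Data.Integer using (+_; _-_; _⊖_; +<+) renaming (_*_ to _*ℤ_; _>_ to _>ℤ_)
open import Data.Integer.Properties using (pos-*; [+m]-[+n]≡m⊖n; ⊖-≥; module ≤-Reasoning)
open import Data.Product using (∃; _×_; _,_; proj₁)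
open import Data.Product.Function.NonDependent.Propositional using (_×-↔_)
open import Data.Sum using (_⊎_; inj₁; inj₂; swap)
open import Data.Sum.Function.Propositional using (_⊎-↔_)
open import Data.List using (List; length; tabulate)
open import Data.List.Properties using (length-tabulate)
open import Data.List.Membership.Propositional using (_∈_; _∉_)
open import Data.List.Membership.Propositional.Properties using (∈-tabulate⁺)
open import Data.List.Membership.Setoid.Properties using (index-injective)
open import Data.List.Relation.Unary.Any using (index)
open import Data.List.Relation.Unary.Unique.Propositional using (Unique)
open import Data.List.Relation.Unary.Unique.Propositional.Properties using (tabulate⁺)
open import Data.Empty using (⊥; ⊥-elim)
open import Function using (_∘_)
open import Function.Bundles using (_↔_; _⇔_; mk⇔; mk↔ₛ′; Inverse; Injection; Equivalence)
open import Function.Definitions using (Injective)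
open import Function.Properties.Inverse using (↔-refl; ↔-sym; ↔-trans; ↔⇒↣)
open import Relation.Binary.Definitions using (tri<; tri≈; tri>)
open import Relation.Binary.PropositionalEquality
  using (_≡_; _≢_; refl; sym; trans; cong; subst; setoid; module ≡-Reasoning)
open import Relation.Nullary using (¬_; Dec; yes; no)

module _ {A B : Set} {K : ℕ} (A↔Fin : A ↔ Fin K) where
  open Inverse A↔Fin using (to; from; strictlyInverseʳ)

  from-injective : Injective _≡_ _≡_ from
  from-injective = Injection.injective (↔⇒↣ (↔-sym A↔Fin))

  image : (A → B) → List B
  image f = tabulate (f ∘ from)

  ∈-image : ∀ f a → f a ∈ image f
  ∈-image f a = subst (λ x → f x ∈ image f) (strictlyInverseʳ a) (∈-tabulate⁺ (to a))

  image-unique : ∀ {f} → Injective _≡_ _≡_ f → Unique (image f)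
  image-unique f-inj = tabulate⁺ (from-injective ∘ f-inj)

  length-image : ∀ f → length (image f) ≡ K
  length-image f = length-tabulate (f ∘ from)

  injection-into-list⇒≤-length : ∀ {f : A → B} {xs} → Injective _≡_ _≡_ f →
                                  (∀ a → f a ∈ xs) → K ≤ length xs
  injection-into-list⇒≤-length f-inj f∈xs = injective⇒≤ {f = index ∘ f∈xs ∘ from} λ e →
    from-injective (f-inj (index-injective (setoid _) (f∈xs _) (f∈xs _) e))

↔Fin-unique : ∀ {A : Set} {m n} → A ↔ Fin m → A ↔ Fin n → m ≡ n
↔Fin-unique A↔m A↔n = cantor-schröder-bernstein
  (Injection.injective (↔⇒↣ m↔n)) (Injection.injective (↔⇒↣ (↔-sym m↔n)))
  where m↔n = ↔-trans (↔-sym A↔m) A↔n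

module _ (G : Graph) where
  open Graph G

  private
    N : Vertex → Vertex → Set
    N = InClosedNbhd G

  InClosedNbhd-sym : ∀ {u v} → N u v → N v u
  InClosedNbhd-sym (inj₁ refl)     = inj₁ refl
  InClosedNbhd-sym (inj₂ (inj₁ e)) = inj₂ (inj₂ e)
  InClosedNbhd-sym (inj₂ (inj₂ e)) = inj₂ (inj₁ e)

  Separates : List Vertex → Vertex → Vertex → Set
  Separates C u v = ∃ λ w → w ∈ C × N u w × ¬ N v w

  OnlyCodeword : List Vertex → Vertex → Vertex → Set
  OnlyCodeword C u x = ∀ {w} → w ∈ C → N u w → w ≡ x

  dominating∧separating⇒identifying : ∀ {C} →
    (∀ v → ∃ λ w → w ∈ C × N v w) →
    (∀ u v → u ≢ v → Separates C u v ⊎ Separates C v u) →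
    IsIdentifyingCode G C
  dominating∧separating⇒identifying dominating separating =
    dominating , λ u v u≢v → refute (separating u v u≢v)
    where
    refute : ∀ {C u v} → Separates C u v ⊎ Separates C v u →
             ¬ (∀ w → w ∈ C → (N u w ⇔ N v w))
    refute (inj₁ (w , w∈C , uw , ¬vw)) same = ¬vw (Equivalence.to (same w w∈C) uw)
    refute (inj₂ (w , w∈C , vw , ¬uw)) same = ¬uw (Equivalence.from (same w w∈C) vw)

  identifying⇒only-codeword-unshared : ∀ {C u v x} → IsIdentifyingCode G C → u ≢ v →
    N u x → N v x → OnlyCodeword C u x → OnlyCodeword C v x → ⊥
  identifying⇒only-codeword-unshared (_ , identifies) u≢v ux vx only-u only-v =
    identifies _ _ u≢v λ w w∈C →
      mk⇔ (λ uw → subst (N _) (sym (only-u w∈C uw)) vx)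
          (λ vw → subst (N _) (sym (only-v w∈C vw)) ux)

-- Offsetting t and Δ lets Fin t and Fin (Δ ∸ 1) be matched on: separating the path
-- vertices needs t ≥ 3, and separating a centre from a leaf needs a second leaf.
module Tree (t′ d : ℕ) where

  t Δ a b : ℕ
  t = 3 + t′
  Δ = 3 + d
  a = Δ ∸ 2
  b = Δ ∸ 1

  V : Set
  V = TV t Δ

  G : Graph
  G = T t Δ

  N : V → V → Set
  N = InClosedNbhd G

  Piece : Set
  Piece = Fin 1 ⊎ Fin a ⊎ (Fin a × Fin b) ⊎ Fin 1

  V↔Fin×Piece : V ↔ (Fin t × Piece)
  V↔Fin×Piece = mk↔ₛ′ to from to-from from-to
    where
    to : V → Fin t × Piece
    to (path j)     = j , inj₁ zero
    to (center j s) = j , inj₂ (inj₁ s)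
    to (leaf j s l) = j , inj₂ (inj₂ (inj₁ (s , l)))
    to (sub j)      = j , inj₂ (inj₂ (inj₂ zero))
    from : Fin t × Piece → V
    from (j , inj₁ _)                     = path j
    from (j , inj₂ (inj₁ s))              = center j s
    from (j , inj₂ (inj₂ (inj₁ (s , l)))) = leaf j s l
    from (j , inj₂ (inj₂ (inj₂ _)))       = sub j
    to-from : ∀ x → to (from x) ≡ x
    to-from (j , inj₁ zero)                  = refl
    to-from (j , inj₂ (inj₁ s))              = refl
    to-from (j , inj₂ (inj₂ (inj₁ (s , l)))) = refl
    to-from (j , inj₂ (inj₂ (inj₂ zero)))    = refl
    from-to : ∀ v → from (to v) ≡ v
    from-to (path j)     = refl
    from-to (center j s) = refl
    from-to (leaf j s l) = refl
    from-to (sub j)      = refl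

  order : ℕ
  order = t * (1 + (a + (a * b + 1)))

  V↔Fin-order : V ↔ Fin order
  V↔Fin-order = ↔-trans V↔Fin×Piece (↔-sym (↔-trans *↔× (↔-refl ×-↔ Fin↔Piece)))
    where
    Fin↔Piece : Fin (1 + (a + (a * b + 1))) ↔ Piece
    Fin↔Piece = ↔-trans +↔⊎ (↔-refl ⊎-↔ ↔-trans +↔⊎ (↔-refl ⊎-↔ ↔-trans +↔⊎ (*↔× ⊎-↔ ↔-refl)))

  _≟V_ : (u v : V) → Dec (u ≡ v)
  _≟V_ = inj⇒≟ (↔⇒↣ V↔Fin-order)

  N-leaf : ∀ {j s l w} → N (leaf j s l) w → w ≡ leaf j s l ⊎ w ≡ center j s
  N-leaf (inj₁ refl)                       = inj₁ refl
  N-leaf (inj₂ (inj₂ (center-leaf _ _ _))) = inj₂ refl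

  leaf-near-center : ∀ {j s l} → N (leaf j s l) (center j s)
  leaf-near-center = inj₂ (inj₂ (center-leaf _ _ _))

  N-sub : ∀ {j w} → N (sub j) w → w ≡ sub j ⊎ w ≡ path j ⊎ w ≡ center j zero
  N-sub (inj₁ refl)                         = inj₁ refl
  N-sub (inj₂ (inj₁ (sub-center _ zero _))) = inj₂ (inj₂ refl)
  N-sub (inj₂ (inj₂ (path-sub _)))          = inj₂ (inj₁ refl)

  N-sub-path : ∀ {i j} → N (sub i) (path j) → j ≡ i
  N-sub-path n with N-sub n
  ... | inj₂ (inj₁ refl) = refl

  N-path-path⇒≤ : ∀ {x y} → N (path x) (path y) → toℕ x ≤ suc (toℕ y)
  N-path-path⇒≤ (inj₁ refl)                       = n≤1+n _
  N-path-path⇒≤ (inj₂ (inj₁ (path-path _ _ y≡1+x))) = m<n⇒m≤1+n (≤-reflexive (sym y≡1+x))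
  N-path-path⇒≤ (inj₂ (inj₂ (path-path _ _ x≡1+y))) = ≤-reflexive x≡1+y

  path-far : ∀ {x y} → suc (toℕ y) < toℕ x → ¬ N (path x) (path y)
  path-far y+1<x xy = <⇒≱ y+1<x (N-path-path⇒≤ xy)

  path-neighbour : ∀ j → ∃ λ c → c ≢ j × N (path j) (path c)
  path-neighbour zero    = suc zero , (λ ()) , inj₂ (inj₁ (path-path zero (suc zero) refl))
  path-neighbour (suc k) = inject₁ k , inject₁k≢1+k ,
    inj₂ (inj₂ (path-path (inject₁ k) (suc k) (cong suc (sym (toℕ-inject₁ k)))))
    where
    inject₁k≢1+k : inject₁ k ≢ suc k
    inject₁k≢1+k e = 1+n≢n (trans (sym (cong toℕ e)) (toℕ-inject₁ k))

  CodeIndex : Set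
  CodeIndex = Fin t × (Fin 1 ⊎ Fin a × Fin b)

  codeSize : ℕ
  codeSize = t * (1 + a * b)

  CodeIndex↔Fin : CodeIndex ↔ Fin codeSize
  CodeIndex↔Fin = ↔-sym (↔-trans *↔× (↔-refl ×-↔ ↔-trans +↔⊎ (↔-refl ⊎-↔ *↔×)))

  codeVertex : CodeIndex → V
  codeVertex (j , inj₁ _)       = path j
  codeVertex (j , inj₂ (s , l)) = leaf j s l

  codeVertex-injective : Injective _≡_ _≡_ codeVertex
  codeVertex-injective {j , inj₁ zero}    {.j , inj₁ zero}      refl = refl
  codeVertex-injective {j , inj₂ (s , l)} {.j , inj₂ (.s , .l)} refl = refl

  code : List V
  code = image CodeIndex↔Fin codeVertex

  path∈code : ∀ j → path j ∈ code
  path∈code j = ∈-image CodeIndex↔Fin codeVertex (j , inj₁ zero)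

  leaf∈code : ∀ j s l → leaf j s l ∈ code
  leaf∈code j s l = ∈-image CodeIndex↔Fin codeVertex (j , inj₂ (s , l))

  Sep : V → V → Set
  Sep = Separates G code

  other : Fin b → Fin b
  other zero    = suc zero
  other (suc _) = zero

  leaf-not-near-sibling : ∀ {j s} l → ¬ N (leaf j s l) (leaf j s (other l))
  leaf-not-near-sibling zero    n with N-leaf n
  ... | inj₁ ()
  leaf-not-near-sibling (suc _) n with N-leaf n
  ... | inj₁ ()

  not-near-leaf : ∀ {j s l v} → v ≢ leaf j s l → v ≢ center j s → ¬ N v (leaf j s l)
  not-near-leaf v≢leaf v≢center n with N-leaf (InClosedNbhd-sym G n)
  ... | inj₁ refl = v≢leaf refl
  ... | inj₂ refl = v≢center refl

  separate-leaf : ∀ j s l v → v ≢ leaf j s l → Sep (leaf j s l) v ⊎ Sep v (leaf j s l)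
  separate-leaf j s l v v≢leaf with v ≟V center j s
  ... | yes refl = inj₂ (leaf j s (other l) , leaf∈code j s (other l) ,
                         inj₂ (inj₁ (center-leaf j s (other l))) , leaf-not-near-sibling l)
  ... | no v≢center = inj₁ (leaf j s l , leaf∈code j s l , inj₁ refl , not-near-leaf v≢leaf v≢center)

  separate-center : ∀ j s v → v ≢ center j s → Sep (center j s) v ⊎ Sep v (center j s)
  separate-center j s v v≢center with v ≟V leaf j s zero
  ... | yes refl = swap (separate-leaf j s zero (center j s) λ ())
  ... | no v≢leaf = inj₁ (leaf j s zero , leaf∈code j s zero , inj₂ (inj₁ (center-leaf j s zero)) ,
                          not-near-leaf v≢leaf v≢center)

  separate-sub-path : ∀ i j → Sep (path j) (sub i)
  separate-sub-path i j with i ≟F j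
  ... | no i≢j   = path j , path∈code j , inj₁ refl , λ n → i≢j (sym (N-sub-path n))
  ... | yes refl with path-neighbour j
  ...   | c , c≢j , jc = path c , path∈code c , jc , λ n → c≢j (N-sub-path n)

  separate-adjacent-paths : ∀ p q → toℕ q ≡ suc (toℕ p) → Sep (path p) (path q) ⊎ Sep (path q) (path p)
  separate-adjacent-paths zero q q≡1 =
    inj₂ (path c , path∈code c , inj₂ (inj₁ (path-path q c (sym (cong suc q≡1)))) ,
          λ n → path-far (s≤s (s≤s z≤n)) (InClosedNbhd-sym G n))
    where c = suc (suc zero)
  separate-adjacent-paths (suc k) q q≡2+k =
    inj₁ (path (inject₁ k) , path∈code (inject₁ k) ,
          inj₂ (inj₂ (path-path (inject₁ k) (suc k) (cong suc (sym (toℕ-inject₁ k))))) ,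
          path-far (≤-reflexive (trans (cong (λ i → suc (suc i)) (toℕ-inject₁ k)) (sym q≡2+k))))

  separate-ordered-paths : ∀ p q → toℕ p < toℕ q → Sep (path p) (path q) ⊎ Sep (path q) (path p)
  separate-ordered-paths p q p<q with m≤n⇒m<n∨m≡n p<q
  ... | inj₁ p+1<q = inj₁ (path p , path∈code p , inj₁ refl , path-far p+1<q)
  ... | inj₂ p+1≡q = separate-adjacent-paths p q (sym p+1≡q)

  separate-paths : ∀ p q → p ≢ q → Sep (path p) (path q) ⊎ Sep (path q) (path p)
  separate-paths p q p≢q with <-cmp (toℕ p) (toℕ q)
  ... | tri< p<q _ _ = separate-ordered-paths p q p<q
  ... | tri≈ _ p≡q _ = ⊥-elim (p≢q (toℕ-injective p≡q))
  ... | tri> _ _ q<p = swap (separate-ordered-paths q p q<p)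

  separate : ∀ u v → u ≢ v → Sep u v ⊎ Sep v u
  separate (leaf j s l) v    u≢v = separate-leaf j s l v (u≢v ∘ sym)
  separate u (leaf j s l)    u≢v = swap (separate-leaf j s l u u≢v)
  separate (center j s) v    u≢v = separate-center j s v (u≢v ∘ sym)
  separate u (center j s)    u≢v = swap (separate-center j s u u≢v)
  separate (sub i) (sub j)   u≢v =
    inj₁ (path i , path∈code i , inj₂ (inj₂ (path-sub i)) , λ n → u≢v (cong sub (N-sub-path n)))
  separate (sub i) (path j)  _   = inj₂ (separate-sub-path i j)
  separate (path j) (sub i)  _   = inj₁ (separate-sub-path i j)
  separate (path p) (path q) u≢v = separate-paths p q (u≢v ∘ cong path)

  code-dominating : ∀ v → ∃ λ w → w ∈ code × N v w
  code-dominating (path j)     = path j , path∈code j , inj₁ refl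
  code-dominating (center j s) = leaf j s zero , leaf∈code j s zero , inj₂ (inj₁ (center-leaf j s zero))
  code-dominating (leaf j s l) = leaf j s l , leaf∈code j s l , inj₁ refl
  code-dominating (sub j)      = path j , path∈code j , inj₂ (inj₂ (path-sub j))

  code-identifying : IsIdentifyingCode G code
  code-identifying = dominating∧separating⇒identifying G code-dominating separate

  module _ {C : List V} (C-identifying : IsIdentifyingCode G C) where

    only-center-near-leaf : ∀ {j s l} → leaf j s l ∉ C → OnlyCodeword G C (leaf j s l) (center j s)
    only-center-near-leaf leaf∉C w∈C n with N-leaf n
    ... | inj₁ refl     = ⊥-elim (leaf∉C w∈C)
    ... | inj₂ w≡center = w≡center

    only-center-near-sub : ∀ {j} → path j ∉ C → sub j ∉ C → OnlyCodeword G C (sub j) (center j zero)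
    only-center-near-sub path∉C sub∉C w∈C n with N-sub n
    ... | inj₁ refl            = ⊥-elim (sub∉C w∈C)
    ... | inj₂ (inj₁ refl)     = ⊥-elim (path∉C w∈C)
    ... | inj₂ (inj₂ w≡center) = w≡center

    sibling-leaves-∉ : ∀ j s l l′ → leaf j s l ∉ C → leaf j s l′ ∉ C → l ≡ l′
    sibling-leaves-∉ j s l l′ l∉C l′∉C with l ≟F l′
    ... | yes l≡l′ = l≡l′
    ... | no l≢l′  = ⊥-elim (identifying⇒only-codeword-unshared G C-identifying
                               (λ { refl → l≢l′ refl }) leaf-near-center leaf-near-center
                               (only-center-near-leaf l∉C) (only-center-near-leaf l′∉C))

    sub∧leaf-∉ : ∀ j l → path j ∉ C → sub j ∉ C → leaf j zero l ∉ C → ⊥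
    sub∧leaf-∉ j l path∉C sub∉C leaf∉C = identifying⇒only-codeword-unshared G C-identifying
      (λ ()) (inj₂ (inj₁ (sub-center j zero refl))) leaf-near-center
      (only-center-near-sub path∉C sub∉C) (only-center-near-leaf leaf∉C)

    open import Data.List.Membership.DecPropositional _≟V_ using (_∈?_)

    leafRep : ∀ j s l → Dec (leaf j s l ∈ C) → V
    leafRep j s l (yes _) = leaf j s l
    leafRep j s l (no _)  = center j s

    pathRep : ∀ j → Dec (path j ∈ C) → Dec (sub j ∈ C) → V
    pathRep j (yes _) _      = path j
    pathRep j (no _) (yes _) = sub j
    pathRep j (no _) (no _)  = center j zero

    rep : CodeIndex → V
    rep (j , inj₁ _)       = pathRep j (path j ∈? C) (sub j ∈? C)
    rep (j , inj₂ (s , l)) = leafRep j s l (leaf j s l ∈? C)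

    leafRep-∈ : ∀ j s l d → leafRep j s l d ∈ C
    leafRep-∈ j s l (yes leaf∈C) = leaf∈C
    leafRep-∈ j s l (no leaf∉C) with proj₁ C-identifying (leaf j s l)
    ... | w , w∈C , n = subst (_∈ C) (only-center-near-leaf leaf∉C w∈C n) w∈C

    pathRep-∈ : ∀ j dp ds → pathRep j dp ds ∈ C
    pathRep-∈ j (yes path∈C) _     = path∈C
    pathRep-∈ j (no _) (yes sub∈C) = sub∈C
    pathRep-∈ j (no path∉C) (no sub∉C) with proj₁ C-identifying (sub j)
    ... | w , w∈C , n = subst (_∈ C) (only-center-near-sub path∉C sub∉C w∈C n) w∈C

    rep-∈ : ∀ r → rep r ∈ C
    rep-∈ (j , inj₁ _)       = pathRep-∈ j _ _
    rep-∈ (j , inj₂ (s , l)) = leafRep-∈ j s l _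

    block : V → Fin t
    block (path j)     = j
    block (center j _) = j
    block (leaf j _ _) = j
    block (sub j)      = j

    block-pathRep : ∀ j dp ds → block (pathRep j dp ds) ≡ j
    block-pathRep j (yes _) _      = refl
    block-pathRep j (no _) (yes _) = refl
    block-pathRep j (no _) (no _)  = refl

    leafRep-injective : ∀ j s l d j′ s′ l′ d′ → leafRep j s l d ≡ leafRep j′ s′ l′ d′ →
                        _≡_ {A = CodeIndex} (j , inj₂ (s , l)) (j′ , inj₂ (s′ , l′))
    leafRep-injective j s l (yes _) .j .s .l (yes _) refl = refl
    leafRep-injective j s l (no l∉C) .j .s l′ (no l′∉C) refl
      rewrite sibling-leaves-∉ j s l l′ l∉C l′∉C = refl

    pathRep≢leafRep : ∀ j dp ds j′ s′ l′ d′ → pathRep j dp ds ≢ leafRep j′ s′ l′ d′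
    pathRep≢leafRep j (yes _) _      j′ s′ l′ (yes _) ()
    pathRep≢leafRep j (yes _) _      j′ s′ l′ (no _)  ()
    pathRep≢leafRep j (no _) (yes _) j′ s′ l′ (yes _) ()
    pathRep≢leafRep j (no _) (yes _) j′ s′ l′ (no _)  ()
    pathRep≢leafRep j (no _) (no _)  j′ s′ l′ (yes _) ()
    pathRep≢leafRep j (no path∉C) (no sub∉C) .j .zero l′ (no leaf∉C) refl =
      sub∧leaf-∉ j l′ path∉C sub∉C leaf∉C

    rep-injective : Injective _≡_ _≡_ rep
    rep-injective {j , inj₁ zero} {j′ , inj₁ zero} e = cong (_, inj₁ zero) (begin
      j                            ≡⟨ block-pathRep j (path j ∈? C) (sub j ∈? C) ⟨
      block (rep (j , inj₁ zero))  ≡⟨ cong block e ⟩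
      block (rep (j′ , inj₁ zero)) ≡⟨ block-pathRep j′ (path j′ ∈? C) (sub j′ ∈? C) ⟩
      j′                           ∎)
      where open ≡-Reasoning
    rep-injective {j , inj₁ zero}    {j′ , inj₂ (s′ , l′)} e = ⊥-elim (pathRep≢leafRep j _ _ j′ s′ l′ _ e)
    rep-injective {j , inj₂ (s , l)} {j′ , inj₁ zero}      e = ⊥-elim (pathRep≢leafRep j′ _ _ j s l _ (sym e))
    rep-injective {j , inj₂ (s , l)} {j′ , inj₂ (s′ , l′)} e = leafRep-injective j s l _ j′ s′ l′ _ e

    codeSize≤length : codeSize ≤ length C
    codeSize≤length = injection-into-list⇒≤-length CodeIndex↔Fin rep-injective rep-∈

  codeSize-isGammaID : IsGammaID G codeSize
  codeSize-isGammaID =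
    (code , image-unique CodeIndex↔Fin codeVertex-injective , code-identifying ,
     length-image CodeIndex↔Fin codeVertex) ,
    λ _ _ C-identifying → codeSize≤length C-identifying

codeSize-ratio : ∀ t a →
  t * (1 + a * suc a) * (suc (suc a) * a + 2) ≡ (suc a * a + 1) * (t * (1 + (a + (a * suc a + 1))))
codeSize-ratio = solve-∀

ratio-gap : ∀ d n → suc d * suc (suc d) * n ≡ (d * d + 3 * d + 1) * n + n
ratio-gap = solve-∀

ratio-gap-scaled : ∀ d n →
  (suc d * d + 1) * n * (suc (suc d) * suc (suc d)) ≡ (d * d + 3 * d + 1) * n * (suc (suc d) * d + 2) + 2 * n
ratio-gap-scaled = solve-∀

ratio-exceeds-bound : ∀ d n → 0 < n → let Δ = 2 + d in
  + (((Δ ∸ 1) * (Δ ∸ 2) + 1) * n * (Δ * Δ)) >ℤ ((+ ((Δ ∸ 1) * Δ * n) - + n) *ℤ + (Δ * (Δ ∸ 2) + 2))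
ratio-exceeds-bound d n n>0 = begin-strict
  (+ (b * Δ * n) - + n) *ℤ + B  ≡⟨ cong (_*ℤ + B) ([+m]-[+n]≡m⊖n (b * Δ * n) n) ⟩
  (b * Δ * n ⊖ n) *ℤ + B         ≡⟨ cong (_*ℤ + B) (⊖-≥ n≤bΔn) ⟩
  + (b * Δ * n ∸ n) *ℤ + B       ≡⟨ cong (λ x → + x *ℤ + B) bΔn∸n≡En ⟩
  + (E * n) *ℤ + B               ≡⟨ pos-* (E * n) B ⟨
  + (E * n * B)                  <⟨ +<+ (m<m+n (E * n * B) (<-≤-trans n>0 (m≤m+n n (1 * n)))) ⟩
  + (E * n * B + 2 * n)          ≡⟨ cong +_ (ratio-gap-scaled d n) ⟨
  + ((b * d + 1) * n * (Δ * Δ))  ∎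
  where
  open ≤-Reasoning
  Δ b B E : ℕ
  Δ = 2 + d
  b = suc d
  B = Δ * d + 2
  E = d * d + 3 * d + 1
  n≤bΔn : n ≤ b * Δ * n
  n≤bΔn = subst (n ≤_) (sym (ratio-gap d n)) (m≤n+m n (E * n))
  bΔn∸n≡En : b * Δ * n ∸ n ≡ E * n
  bΔn∸n≡En = trans (cong (_∸ n) (ratio-gap d n)) (m+n∸n≡m (E * n) n)

proposition6p1 : (t Δ : ℕ) → 3 ≤ t → 4 ≤ Δ →
    (n : ℕ) → (TV t Δ ↔ Fin n) →
    ∃ λ k → IsGammaID (T t Δ) k
      × k * (Δ * (Δ ∸ 2) + 2) ≡ ((Δ ∸ 1) * (Δ ∸ 2) + 1) * n
      × (+ (((Δ ∸ 1) * (Δ ∸ 2) + 1) * n * (Δ * Δ))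
          >ℤ ((+ ((Δ ∸ 1) * Δ * n) - + n) *ℤ + (Δ * (Δ ∸ 2) + 2)))
proposition6p1 t Δ (s≤s (s≤s (s≤s (z≤n {t′})))) (s≤s (s≤s (s≤s (s≤s (z≤n {d}))))) n V↔Fin-n =
  codeSize , codeSize-isGammaID ,
  subst (λ m → codeSize * (Δ * (Δ ∸ 2) + 2) ≡ ((Δ ∸ 1) * (Δ ∸ 2) + 1) * m)
        (sym n≡order) (codeSize-ratio t (Δ ∸ 2)) ,
  ratio-exceeds-bound (Δ ∸ 2) n (subst (0 <_) (sym n≡order) (s≤s z≤n))
  where
  open Tree t′ (suc d) using (codeSize; codeSize-isGammaID; order; V↔Fin-order)
  n≡order : n ≡ order
  n≡order = ↔Fin-unique V↔Fin-n V↔Fin-order
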